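{- The chromatic symmetric homology $H_1(K_{3,3};\mathbb{Z})$ of the complete bipartite graph $K_{3,3}$ (in $q$-degree zero) contains $\mathbb{Z}_2$-torsion, i.e. it has an element of additive order $2$.
   Context: Let $G$ be a simple graph with vertex set $[n]$; order its edges $e_{ij}$ ($i<j$) lexicographically by $(i,j)$. For $F\subseteq E(G)$, let $B_1,\dots,B_r$ be the vertex sets of the connected components of $([n],F)$, $\mathfrak{S}_{\beta(F)}=\mathfrak{S}_{B_1}\times\cdots\times\mathfrak{S}_{B_r}$, $a_F=\sum_{\sigma\in\mathfrak{S}_{\beta(F)}}\sigma\in\mathbb{Z}[\mathfrak{S}_n]$, and $\mathcal{M}_F=\mathbb{Z}[\mathfrak{S}_n]a_F$ (isomorphic to the integral permutation module induced from the trivial module of $\mathfrak{S}_{\beta(F)}$). For $e\in F$, $\mathcal{M}_F\subseteq\mathcal{M}_{F\setminus e}$ and $d_{F,e}$ is the inclusion. $C_i=\bigoplus_{|F|=i}\mathcal{M}_F$, $d_i|_{\mathcal{M}_F}=\sum_{e\in F}(-1)^{\#\{e'\in F:e'<e\}}d_{F,e}$, and $H_i(G;\mathbb{Z})=\ker d_i/\operatorname{im}d_{i+1}$. -}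

module Defs where

open import Data.Nat as ℕ using (ℕ; zero; suc; _<ᵇ_)
open import Data.Integer as ℤ using (ℤ; 1ℤ; -_)
open import Data.Bool using (Bool; true; false; _∧_; _∨_; if_then_else_; not; T)
open import Data.Fin as Fin using (Fin; toℕ)
open import Data.Fin.Properties using () renaming (_≟_ to _≟ᶠ_)
open import Data.Fin.Subset using (Subset; ∣_∣)
open import Data.Vec as Vec using (Vec; []; _∷_; tabulate; _[_]≔_)
open import Data.Vec.Properties using (≡-dec)
open import Data.List as List using (List; []; _∷_; _++_; map; concatMap; allFin; length; filterᵇ; foldr)
open import Data.Bool.ListAction using (all; any)
open import Data.List.Relation.Unary.All using (All)
open import Data.Product using (Σ; _×_; _,_; proj₁; proj₂; ∃)
open import Relation.Nullary using (¬_; does)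
open import Relation.Binary.PropositionalEquality using (_≡_; _≢_)

-- Simple graphs on the vertex set Fin n  (= [n], vertex k+1 ↦ k)

record SimpleGraph (n : ℕ) : Set where
  field
    adj    : Fin n → Fin n → Bool
    sym    : ∀ i j → adj i j ≡ adj j i
    irrefl : ∀ i → adj i i ≡ false
open SimpleGraph public

_==ᶠ_ : ∀ {n} → Fin n → Fin n → Bool
i ==ᶠ j = does (i ≟ᶠ j)

edges : ∀ {n} → SimpleGraph n → List (Fin n × Fin n)
edges {n} G = concatMap (λ i → concatMap (λ j →
  if (toℕ i <ᵇ toℕ j) ∧ adj G i j then (i , j) ∷ [] else []) (allFin n)) (allFin n)

-- number of edges; edges are indexed by Fin (#E G), index order = lex order
#E : ∀ {n} → SimpleGraph n → ℕ
#E G = length (edges G)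

edge : ∀ {n} (G : SimpleGraph n) → Fin (#E G) → Fin n × Fin n
edge G = List.lookup (edges G)

EdgeSet : ∀ {n} → SimpleGraph n → Set
EdgeSet G = Subset (#E G)

adjF : ∀ {n} (G : SimpleGraph n) → EdgeSet G → Fin n → Fin n → Bool
adjF G F u v = any (λ e → Vec.lookup F e ∧
   (((proj₁ (edge G e) ==ᶠ u) ∧ (proj₂ (edge G e) ==ᶠ v)) ∨
    ((proj₁ (edge G e) ==ᶠ v) ∧ (proj₂ (edge G e) ==ᶠ u)))) (allFin (#E G))

reach : ∀ {n} (G : SimpleGraph n) → EdgeSet G → ℕ → Fin n → Fin n → Bool
reach G F zero    u v = u ==ᶠ v
reach {n} G F (suc k) u v = reach G F k u v ∨ any (λ w → reach G F k u w ∧ adjF G F w v) (allFin n)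

sameComp : ∀ {n} (G : SimpleGraph n) → EdgeSet G → Fin n → Fin n → Bool
sameComp {n} G F = reach G F n

Map : ℕ → Set
Map n = Vec (Fin n) n

allVecs : ∀ {n} (k : ℕ) → List (Vec (Fin n) k)
allVecs zero = [] ∷ []
allVecs {n} (suc k) = concatMap (λ i → map (i ∷_) (allVecs k)) (allFin n)

allMaps : ∀ n → List (Map n)
allMaps n = allVecs n

isPerm : ∀ {n} → Map n → Bool
isPerm {n} σ = all (λ i → all (λ j →
  not (Vec.lookup σ i ==ᶠ Vec.lookup σ j) ∨ (i ==ᶠ j)) (allFin n)) (allFin n)

_∘ᵐ_ : ∀ {n} → Map n → Map n → Map n
σ ∘ᵐ τ = tabulate (λ i → Vec.lookup σ (Vec.lookup τ i))

ℤS : ℕ → Set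
ℤS n = List (ℤ × Map n)

-- an element genuinely lies in ℤ[𝔖_n] (all its terms are permutations)
InℤS : ∀ {n} → ℤS n → Set
InℤS x = All (λ t → T (isPerm (proj₂ t))) x

coeff : ∀ {n} → ℤS n → Map n → ℤ
coeff x σ = foldr ℤ._+_ ℤ.0ℤ
  (map proj₁ (filterᵇ (λ t → does (≡-dec _≟ᶠ_ (proj₂ t) σ)) x))

_≋_ : ∀ {n} → ℤS n → ℤS n → Set
x ≋ y = ∀ σ → coeff x σ ≡ coeff y σ

0ˢ : ∀ {n} → ℤS n
0ˢ = []

_+ˢ_ : ∀ {n} → ℤS n → ℤS n → ℤS n
_+ˢ_ = _++_

_·ˢ_ : ∀ {n} → ℤ → ℤS n → ℤS n
k ·ˢ x = map (λ t → (k ℤ.* proj₁ t , proj₂ t)) x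

_*ˢ_ : ∀ {n} → ℤS n → ℤS n → ℤS n
x *ˢ y = concatMap (λ s → map (λ t → (proj₁ s ℤ.* proj₁ t , proj₂ s ∘ᵐ proj₂ t)) y) x

inYoung : ∀ {n} (G : SimpleGraph n) → EdgeSet G → Map n → Bool
inYoung {n} G F σ = isPerm σ ∧ all (λ u → sameComp G F u (Vec.lookup σ u)) (allFin n)

a : ∀ {n} (G : SimpleGraph n) → EdgeSet G → ℤS n
a {n} G F = map (λ σ → (1ℤ , σ)) (filterᵇ (inYoung G F) (allMaps n))

InM : ∀ {n} (G : SimpleGraph n) → EdgeSet G → ℤS n → Set
InM {n} G F x = Σ (ℤS n) λ y → InℤS y × (x ≋ (y *ˢ a G F))

-- Chains: C_i = ⊕_{|F| = i} 𝓜_F, represented as a function on all edge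
-- subsets that vanishes off |F| = i.

Chain : ∀ {n} → SimpleGraph n → Set
Chain {n} G = EdgeSet G → ℤS n

IsChain : ∀ {n} (G : SimpleGraph n) → ℕ → Chain G → Set
IsChain G i c = ∀ F → (∣ F ∣ ≡ i → InM G F (c F)) × (∣ F ∣ ≢ i → c F ≋ 0ˢ)

countBelow : ∀ {m} → Subset m → Fin m → ℕ
countBelow {m} F e = length (filterᵇ (λ e' → Vec.lookup F e' ∧ (toℕ e' <ᵇ toℕ e)) (allFin m))

-- The differential: for F' , (d c)(F') = Σ_{e ∉ F'} (-1)^{#{e' ∈ F'∪e : e' < e}} c(F' ∪ e),
-- i.e. d|_{𝓜_F} = Σ_{e∈F} (-1)^{#{e'∈F : e'<e}} d_{F,e}.
d : ∀ {n} (G : SimpleGraph n) → Chain G → Chain G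
d G c F' = concatMap (λ e →
  if Vec.lookup F' e then []
  else ((- 1ℤ) ℤ.^ countBelow F' e) ·ˢ c (F' [ e ]≔ true)) (allFin (#E G))

IsCycle : ∀ {n} (G : SimpleGraph n) → ℕ → Chain G → Set
IsCycle G i c = IsChain G i c × (∀ F → d G c F ≋ 0ˢ)

IsBoundary : ∀ {n} (G : SimpleGraph n) → ℕ → Chain G → Set
IsBoundary G i c = Σ (Chain G) λ z → IsChain G (suc i) z × (∀ F → d G z F ≋ c F)

scaleᶜ : ∀ {n} (G : SimpleGraph n) → ℤ → Chain G → Chain G
scaleᶜ G k c F = k ·ˢ c F

HasOrder2Class : ∀ {n} (G : SimpleGraph n) → ℕ → Set
HasOrder2Class G i = Σ (Chain G) λ c →
  IsCycle G i c × ¬ IsBoundary G i c × IsBoundary G i (scaleᶜ G (ℤ.+ 2) c)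

-- K_{3,3} on [6] with parts {1,2,3} and {4,5,6}  (Fin: {0,1,2}, {3,4,5})

side : Fin 6 → Bool
side i = toℕ i <ᵇ 3

xorB : Bool → Bool → Bool
xorB true b = not b
xorB false b = b

K33 : SimpleGraph 6
K33 = record
  { adj = λ i j → xorB (side i) (side j)
  ; sym = symK
  ; irrefl = irrK }
  where
  open import Relation.Binary.PropositionalEquality using (refl)
  symK : ∀ i j → xorB (side i) (side j) ≡ xorB (side j) (side i)
  symK i j with side i | side j
  ... | true  | true  = refl
  ... | true  | false = refl
  ... | false | true  = refl
  ... | false | false = refl
  irrK : ∀ i → xorB (side i) (side i) ≡ false
  irrK i with side i
  ... | true  = refl
  ... | false = refl

{-# OPTIONS --safe #-}
-- Explicit chains c ∈ C₁ and z ∈ C₂ are given by tables F ↦ y_F with c_F = y_F a_F (likewise z).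
-- The identities dc = 0 and dz = 2c are finite identities in ℤ[𝔖₆], checked by evaluation once each
-- a_F is replaced by the sum over the Young subgroup of F, computed from a component labelling that is
-- itself checked.
--
-- That c is not a boundary is witnessed by the linear functional Φ(w) = Σ_e h_e(w_{e}) on C₁, where
-- h_e : 𝔖₆ → {0,1} depends only on σ⁻¹{5,6}. Φ(c) is odd. For z ∈ C₂ the terms of Φ(dz) coming from
-- z_F, F = {e,e′}, add up to ±h_e(z_F) ± h_{e′}(z_F), which has the parity of (h_e + h_{e′})(z_F).
-- Writing z_F = y a_F, this is Σ_σ y_σ Σ_{τ ∈ 𝔖_β(F)} (h_e + h_{e′})(στ), and every inner sum is even:
-- as (στ)⁻¹{5,6} = τ⁻¹(σ⁻¹{5,6}), that is a check over the 2⁶ possible sets σ⁻¹{5,6}. So Φ(dz) is even.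
module Submission where

open import Defs hiding (sym)
open import Data.Bool using (Bool; true; false; _∧_; if_then_else_; T)
open import Data.Bool.ListAction using (all; any)
open import Data.Bool.Properties using (T-≡; T-∧; ¬-not) renaming (_≟_ to _≟ᵇ_)
open import Data.Fin using (Fin; zero; suc; #_)
open import Data.Fin.Properties using (all?) renaming (_≟_ to _≟ᶠ_)
open import Data.Fin.Subset using (Subset; ⊥; ⁅_⁆; ∣_∣)
open import Data.Fin.Subset.Properties using (∣⁅x⁆∣≡1; x∈⁅x⁆; x∈⁅y⁆⇒x≡y)
open import Data.Integer as ℤ using (ℤ; +_; 0ℤ; 1ℤ; _+_; _*_; -_; _-_; _^_)
open import Data.Integer.Divisibility.Signed using (_∣_; _∣?_; divides; ∣m∣n⇒∣m+n; ∣m∣n⇒∣m-n; ∣n⇒∣m*n)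
open import Data.Integer.Properties as ℤ
  using (+-identityˡ; +-identityʳ; +-assoc; +-comm; *-zeroʳ; *-identityʳ; *-identityˡ; *-distribˡ-+; *-distribʳ-+; *-assoc)
open import Data.Integer.Solver using (module +-*-Solver)
open import Algebra.Properties.CommutativeSemigroup ℤ.+-commutativeSemigroup using (interchange)
open import Data.List as List using (List; []; _∷_; _++_; map; concatMap; allFin; filterᵇ)
open import Data.List.Properties using (map-tabulate)
open import Data.List.Relation.Unary.All as All using (All; []; _∷_; lookupAny)
open import Data.List.Relation.Unary.All.Properties using (++⁺)
open import Data.List.Relation.Unary.Any using (Any; here; there; satisfied)
open import Data.List.Relation.Unary.Any.Properties using (any⁻)
open import Data.Nat as ℕ using (ℕ)
open import Data.Product using (_×_; _,_; proj₁; proj₂)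
open import Data.Sum as Sum using (_⊎_; inj₁; inj₂)
open import Data.Unit using (tt)
open import Data.Vec as Vec using (Vec; []; _∷_; _[_]≔_)
open import Data.Vec.Properties
  using (≡-dec; []=⇒lookup; lookup⇒[]=; lookup∘update; lookup∘update′; lookup-replicate; lookup-map; tabulate-∘; tabulate-cong)
open import Function using (_∘_; id)
open import Function.Bundles using (Equivalence)
open import Relation.Binary.PropositionalEquality
open import Relation.Nullary using (¬_; Dec; yes; no; does; contradiction)
open import Relation.Nullary.Decidable using (T?; _×-dec_; _→-dec_; map′; from-yes; from-no)

module _ {A : Set} where

  ∑ : List A → (A → ℤ) → ℤ
  ∑ []       f = 0ℤ
  ∑ (x ∷ xs) f = f x + ∑ xs f

  ∑-cong : ∀ xs {f g : A → ℤ} → (∀ x → f x ≡ g x) → ∑ xs f ≡ ∑ xs g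
  ∑-cong []       f≗g = refl
  ∑-cong (x ∷ xs) f≗g = cong₂ _+_ (f≗g x) (∑-cong xs f≗g)

  ∑-zero : ∀ xs → ∑ xs (λ _ → 0ℤ) ≡ 0ℤ
  ∑-zero []       = refl
  ∑-zero (x ∷ xs) = trans (+-identityˡ _) (∑-zero xs)

  ∑-++ : ∀ xs ys f → ∑ (xs ++ ys) f ≡ ∑ xs f + ∑ ys f
  ∑-++ []       ys f = sym (+-identityˡ _)
  ∑-++ (x ∷ xs) ys f = trans (cong (_+_ (f x)) (∑-++ xs ys f)) (sym (+-assoc (f x) _ _))

  ∑-+ : ∀ xs f g → ∑ xs (λ x → f x + g x) ≡ ∑ xs f + ∑ xs g
  ∑-+ []       f g = refl
  ∑-+ (x ∷ xs) f g = trans (cong (_+_ (f x + g x)) (∑-+ xs f g)) (interchange (f x) (g x) _ _)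

  ∑-*ˡ : ∀ xs k f → ∑ xs (λ x → k * f x) ≡ k * ∑ xs f
  ∑-*ˡ []       k f = sym (*-zeroʳ k)
  ∑-*ˡ (x ∷ xs) k f = trans (cong (_+_ (k * f x)) (∑-*ˡ xs k f)) (sym (*-distribˡ-+ k (f x) _))

  ∑-filter : ∀ p xs f → ∑ (filterᵇ p xs) f ≡ ∑ xs (λ x → if p x then f x else 0ℤ)
  ∑-filter p []       f = refl
  ∑-filter p (x ∷ xs) f with p x
  ... | true  = cong (_+_ (f x)) (∑-filter p xs f)
  ... | false = trans (∑-filter p xs f) (sym (+-identityˡ _))

module _ {A B : Set} where

  ∑-map : ∀ (g : A → B) xs f → ∑ (map g xs) f ≡ ∑ xs (f ∘ g)
  ∑-map g []       f = refl
  ∑-map g (x ∷ xs) f = cong (_+_ (f (g x))) (∑-map g xs f)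

  ∑-concatMap : ∀ (g : A → List B) xs f → ∑ (concatMap g xs) f ≡ ∑ xs (λ x → ∑ (g x) f)
  ∑-concatMap g []       f = refl
  ∑-concatMap g (x ∷ xs) f = trans (∑-++ (g x) _ f) (cong (_+_ (∑ (g x) f)) (∑-concatMap g xs f))

∑-allFin-suc : ∀ {n} (f : Fin (ℕ.suc n) → ℤ) → ∑ (allFin (ℕ.suc n)) f ≡ f zero + ∑ (allFin n) (f ∘ suc)
∑-allFin-suc {n} f =
  cong (_+_ (f zero)) (trans (cong (λ xs → ∑ xs f) (sym (map-tabulate id suc))) (∑-map suc (allFin n) f))

∑-allFin-δ : ∀ {n} (j : Fin n) (g : Fin n → ℤ) → ∑ (allFin n) (λ i → if j ==ᶠ i then g i else 0ℤ) ≡ g j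
∑-allFin-δ {ℕ.suc n} zero    g = trans (∑-allFin-suc (λ i → if zero ==ᶠ i then g i else 0ℤ))
  (trans (cong (_+_ (g zero)) (∑-zero (allFin n))) (+-identityʳ _))
∑-allFin-δ {ℕ.suc n} (suc j) g = trans (∑-allFin-suc (λ i → if suc j ==ᶠ i then g i else 0ℤ))
  (trans (+-identityˡ _) (∑-allFin-δ j (g ∘ suc)))

all-map : ∀ {A B : Set} (p : B → Bool) (g : A → B) xs → all p (map g xs) ≡ all (p ∘ g) xs
all-map p g []       = refl
all-map p g (x ∷ xs) = cong (p (g x) ∧_) (all-map p g xs)

all-cong : ∀ {A : Set} xs {p q : A → Bool} → (∀ x → p x ≡ q x) → all p xs ≡ all q xs
all-cong []       p≗q = refl
all-cong (x ∷ xs) p≗q = cong₂ _∧_ (p≗q x) (all-cong xs p≗q)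

all-allFin-suc : ∀ {k} (p : Fin (ℕ.suc k) → Bool) → all p (allFin (ℕ.suc k)) ≡ p zero ∧ all (p ∘ suc) (allFin k)
all-allFin-suc {k} p = cong (p zero ∧_) (trans (cong (all p) (sym (map-tabulate id suc))) (all-map p suc (allFin k)))

_==ᵛ_ : ∀ {n k} → Vec (Fin n) k → Vec (Fin n) k → Bool
v ==ᵛ w = does (≡-dec _≟ᶠ_ v w)

==ᵛ-sym : ∀ {n k} (v w : Vec (Fin n) k) → v ==ᵛ w ≡ w ==ᵛ v
==ᵛ-sym v w with ≡-dec _≟ᶠ_ v w | ≡-dec _≟ᶠ_ w v
... | yes _   | yes _   = refl
... | no  _   | no  _   = refl
... | yes v≡w | no  w≢v = contradiction (sym v≡w) w≢v
... | no  v≢w | yes w≡v = contradiction (sym w≡v) v≢w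

pointwise : ∀ {n k} → (Fin k → Fin n → Bool) → Vec (Fin n) k → Bool
pointwise {k = k} P w = all (λ i → P i (Vec.lookup w i)) (allFin k)

vecsWhere : ∀ {n} k → (Fin k → Fin n → Bool) → List (Vec (Fin n) k)
vecsWhere     ℕ.zero    P = [] ∷ []
vecsWhere {n} (ℕ.suc k) P = concatMap (λ i → map (i ∷_) (vecsWhere k (P ∘ suc))) (filterᵇ (P zero) (allFin n))

∑-vecsWhere-δ : ∀ {n} k P (w : Vec (Fin n) k) (g : Vec (Fin n) k → ℤ) →
                ∑ (vecsWhere k P) (λ v → if w ==ᵛ v then g v else 0ℤ) ≡ (if pointwise P w then g w else 0ℤ)
∑-vecsWhere-δ ℕ.zero P [] g = +-identityʳ _
∑-vecsWhere-δ {n} (ℕ.suc k) P (j ∷ w) g = begin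
    ∑ (vecsWhere (ℕ.suc k) P) δ-at
  ≡⟨ ∑-concatMap (λ i → map (i ∷_) rest) (filterᵇ (P zero) (allFin n)) δ-at ⟩
    ∑ (filterᵇ (P zero) (allFin n)) (λ i → ∑ (map (i ∷_) rest) δ-at)
  ≡⟨ ∑-filter (P zero) (allFin n) _ ⟩
    ∑ (allFin n) (λ i → if P zero i then ∑ (map (i ∷_) rest) δ-at else 0ℤ)
  ≡⟨ ∑-cong (allFin n) column ⟩
    ∑ (allFin n) (λ i → if j ==ᶠ i then X i else 0ℤ)
  ≡⟨ ∑-allFin-δ j X ⟩
    X j
  ≡⟨ cong (λ b → if b then g (j ∷ w) else 0ℤ) (sym (all-allFin-suc (λ i → P i (Vec.lookup (j ∷ w) i)))) ⟩
    (if pointwise P (j ∷ w) then g (j ∷ w) else 0ℤ) ∎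
  where
  open ≡-Reasoning
  rest = vecsWhere k (P ∘ suc)
  δ-at : Vec (Fin n) (ℕ.suc k) → ℤ
  δ-at v = if (j ∷ w) ==ᵛ v then g v else 0ℤ
  X : Fin n → ℤ
  X i = if P zero i ∧ pointwise (P ∘ suc) w then g (i ∷ w) else 0ℤ
  column : ∀ i → (if P zero i then ∑ (map (i ∷_) rest) δ-at else 0ℤ) ≡ (if j ==ᶠ i then X i else 0ℤ)
  column i with P zero i | j ==ᶠ i in j≟i
  ... | false | false = refl
  ... | false | true  = refl
  ... | true  | false = trans (∑-map (i ∷_) rest δ-at)
          (trans (∑-cong rest (λ v → cong (λ b → if b ∧ (w ==ᵛ v) then g (i ∷ v) else 0ℤ) j≟i)) (∑-zero rest))
  ... | true  | true  = trans (∑-map (i ∷_) rest δ-at)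
          (trans (∑-cong rest (λ v → cong (λ b → if b ∧ (w ==ᵛ v) then g (i ∷ v) else 0ℤ) j≟i))
                 (∑-vecsWhere-δ k (P ∘ suc) w (λ v → g (i ∷ v))))

∑-allVecs≡∑-vecsWhere-true : ∀ {n} k (f : Vec (Fin n) k → ℤ) → ∑ (allVecs k) f ≡ ∑ (vecsWhere k (λ _ _ → true)) f
∑-allVecs≡∑-vecsWhere-true ℕ.zero    f = refl
∑-allVecs≡∑-vecsWhere-true {n} (ℕ.suc k) f = begin
    ∑ (allVecs (ℕ.suc k)) f
  ≡⟨ ∑-concatMap (λ i → map (i ∷_) (allVecs k)) (allFin n) f ⟩
    ∑ (allFin n) (λ i → ∑ (map (i ∷_) (allVecs k)) f)
  ≡⟨ ∑-cong (allFin n) (λ i → trans (∑-map (i ∷_) (allVecs k) f)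
       (trans (∑-allVecs≡∑-vecsWhere-true k (f ∘ (i ∷_))) (sym (∑-map (i ∷_) (vecsWhere k (λ _ _ → true)) f)))) ⟩
    ∑ (allFin n) (λ i → ∑ (map (i ∷_) (vecsWhere k (λ _ _ → true))) f)
  ≡⟨ sym (∑-filter (λ _ → true) (allFin n) (λ i → ∑ (map (i ∷_) (vecsWhere k (λ _ _ → true))) f)) ⟩
    ∑ (filterᵇ (λ _ → true) (allFin n)) (λ i → ∑ (map (i ∷_) (vecsWhere k (λ _ _ → true))) f)
  ≡⟨ sym (∑-concatMap (λ i → map (i ∷_) (vecsWhere k (λ _ _ → true))) (filterᵇ (λ _ → true) (allFin n)) f) ⟩
    ∑ (vecsWhere (ℕ.suc k) (λ _ _ → true)) f ∎
  where open ≡-Reasoning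

pointwise-true : ∀ {n} k (w : Vec (Fin n) k) → pointwise (λ _ _ → true) w ≡ true
pointwise-true ℕ.zero    []      = refl
pointwise-true (ℕ.suc k) (j ∷ w) = trans (all-allFin-suc {k} (λ _ → true)) (pointwise-true k w)

∑-allVecs-δ : ∀ {n} k (w : Vec (Fin n) k) (g : Vec (Fin n) k → ℤ) →
              ∑ (allVecs k) (λ v → if w ==ᵛ v then g v else 0ℤ) ≡ g w
∑-allVecs-δ k w g = trans (∑-allVecs≡∑-vecsWhere-true k _)
  (trans (∑-vecsWhere-δ k (λ _ _ → true) w g) (cong (λ b → if b then g w else 0ℤ) (pointwise-true k w)))

-- Linear functionals on ℤ[𝔖ₙ]

ones : ∀ {n} → List (Map n) → ℤS n
ones = map (1ℤ ,_)

linear : ∀ {n} → (Map n → ℤ) → ℤS n → ℤ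
linear f x = ∑ x (λ t → proj₁ t * f (proj₂ t))

indicator : Bool → ℤ
indicator b = if b then 1ℤ else 0ℤ

δ : ∀ {n} → Map n → Map n → ℤ
δ σ π = indicator (π ==ᵛ σ)

coeff≡linear-δ : ∀ {n} (x : ℤS n) σ → coeff x σ ≡ linear (δ σ) x
coeff≡linear-δ []            σ = refl
coeff≡linear-δ ((k , π) ∷ x) σ with π ==ᵛ σ
... | true  = cong₂ _+_ (sym (*-identityʳ k)) (coeff≡linear-δ x σ)
... | false = trans (coeff≡linear-δ x σ) (sym (trans (cong (_+ linear (δ σ) x) (*-zeroʳ k)) (+-identityˡ _)))

≋-from-linear : ∀ {n} (x y : ℤS n) → (∀ σ → linear (δ σ) x ≡ linear (δ σ) y) → x ≋ y
≋-from-linear x y eq σ = trans (coeff≡linear-δ x σ) (trans (eq σ) (sym (coeff≡linear-δ y σ)))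

linear-via-coeff : ∀ {n} (f : Map n → ℤ) (x : ℤS n) → linear f x ≡ ∑ (allMaps n) (λ π → coeff x π * f π)
linear-via-coeff {n} f [] = sym (trans (∑-cong (allMaps n) (λ π → ℤ.*-zeroˡ (f π))) (∑-zero (allMaps n)))
linear-via-coeff {n} f ((k , σ) ∷ x) = begin
    k * f σ + linear f x
  ≡⟨ cong₂ _+_ (cong (k *_) (sym (∑-allVecs-δ n σ f))) (linear-via-coeff f x) ⟩
    k * ∑ (allMaps n) (λ π → if σ ==ᵛ π then f π else 0ℤ) + ∑ (allMaps n) (λ π → coeff x π * f π)
  ≡⟨ cong (_+ ∑ (allMaps n) (λ π → coeff x π * f π)) (sym (∑-*ˡ (allMaps n) k _)) ⟩
    ∑ (allMaps n) (λ π → k * (if σ ==ᵛ π then f π else 0ℤ)) + ∑ (allMaps n) (λ π → coeff x π * f π)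
  ≡⟨ sym (∑-+ (allMaps n) _ _) ⟩
    ∑ (allMaps n) (λ π → k * (if σ ==ᵛ π then f π else 0ℤ) + coeff x π * f π)
  ≡⟨ ∑-cong (allMaps n) termwise ⟩
    ∑ (allMaps n) (λ π → coeff ((k , σ) ∷ x) π * f π) ∎
  where
  open ≡-Reasoning
  termwise : ∀ π → k * (if σ ==ᵛ π then f π else 0ℤ) + coeff x π * f π ≡ coeff ((k , σ) ∷ x) π * f π
  termwise π with σ ==ᵛ π
  ... | true  = sym (*-distribʳ-+ (f π) k (coeff x π))
  ... | false = trans (cong (_+ coeff x π * f π) (*-zeroʳ k)) (+-identityˡ _)

linear-resp-≋ : ∀ {n} (f : Map n → ℤ) (x y : ℤS n) → x ≋ y → linear f x ≡ linear f y
linear-resp-≋ {n} f x y x≋y = begin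
  linear f x                                 ≡⟨ linear-via-coeff f x ⟩
  ∑ (allMaps n) (λ π → coeff x π * f π)      ≡⟨ ∑-cong (allMaps n) (λ π → cong (_* f π) (x≋y π)) ⟩
  ∑ (allMaps n) (λ π → coeff y π * f π)      ≡⟨ linear-via-coeff f y ⟨
  linear f y                                 ∎
  where open ≡-Reasoning

linear-cong : ∀ {n} {f g : Map n → ℤ} (x : ℤS n) → (∀ σ → f σ ≡ g σ) → linear f x ≡ linear g x
linear-cong x f≗g = ∑-cong x (λ t → cong (proj₁ t *_) (f≗g (proj₂ t)))

linear-+ : ∀ {n} (f g : Map n → ℤ) (x : ℤS n) → linear (λ σ → f σ + g σ) x ≡ linear f x + linear g x
linear-+ f g x = trans (∑-cong x (λ t → *-distribˡ-+ (proj₁ t) (f (proj₂ t)) (g (proj₂ t)))) (∑-+ x _ _)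

linear-++ : ∀ {n} (f : Map n → ℤ) (x y : ℤS n) → linear f (x ++ y) ≡ linear f x + linear f y
linear-++ f x y = ∑-++ x y _

linear-· : ∀ {n} (f : Map n → ℤ) k (x : ℤS n) → linear f (k ·ˢ x) ≡ k * linear f x
linear-· f k x = trans (∑-map _ x _) (trans (∑-cong x (λ t → *-assoc k (proj₁ t) (f (proj₂ t)))) (∑-*ˡ x k _))

linear-*ˢ : ∀ {n} (f : Map n → ℤ) (y x : ℤS n) → linear f (y *ˢ x) ≡ linear (λ σ → linear (λ τ → f (σ ∘ᵐ τ)) x) y
linear-*ˢ f y x = trans (∑-concatMap _ y _) (∑-cong y (λ s → trans (∑-map _ x _)
  (trans (∑-cong x (λ t → *-assoc (proj₁ s) (proj₁ t) _)) (∑-*ˡ x (proj₁ s) _))))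

linear-ones : ∀ {n} (f : Map n → ℤ) (L : List (Map n)) → linear f (ones L) ≡ ∑ L f
linear-ones f L = trans (∑-map _ L _) (∑-cong L (λ τ → *-identityˡ (f τ)))

linear-δ-ones-filter : ∀ {n} σ p (L : List (Map n)) →
                       linear (δ σ) (ones (filterᵇ p L)) ≡ ∑ L (λ τ → if σ ==ᵛ τ then indicator (p τ) else 0ℤ)
linear-δ-ones-filter σ p L = trans (linear-ones (δ σ) (filterᵇ p L)) (trans (∑-filter p L (δ σ)) (∑-cong L select))
  where
  select : ∀ τ → (if p τ then δ σ τ else 0ℤ) ≡ (if σ ==ᵛ τ then indicator (p τ) else 0ℤ)
  select τ with p τ
  ... | true  = cong indicator (==ᵛ-sym τ σ)
  ... | false with σ ==ᵛ τ
  ...   | true  = refl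
  ...   | false = refl

sign : ℕ → ℤ
sign m = (- 1ℤ) ^ m

linear-d : ∀ {n} (G : SimpleGraph n) (f : Map n → ℤ) (c : Chain G) (F : EdgeSet G) →
           linear f (d G c F) ≡ ∑ (allFin (#E G)) (λ e →
             if Vec.lookup F e then 0ℤ else sign (countBelow F e) * linear f (c (F [ e ]≔ true)))
linear-d G f c F = trans (∑-concatMap _ (allFin (#E G)) _) (∑-cong (allFin (#E G)) term)
  where
  term : ∀ e → linear f (if Vec.lookup F e then [] else sign (countBelow F e) ·ˢ c (F [ e ]≔ true))
             ≡ (if Vec.lookup F e then 0ℤ else sign (countBelow F e) * linear f (c (F [ e ]≔ true)))
  term e with Vec.lookup F e
  ... | true  = refl
  ... | false = linear-· f (sign (countBelow F e)) (c (F [ e ]≔ true))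

*ˢ-congʳ : ∀ {n} (y : ℤS n) {x x′ : ℤS n} → x ≋ x′ → (y *ˢ x) ≋ (y *ˢ x′)
*ˢ-congʳ y {x} {x′} x≋x′ = ≋-from-linear (y *ˢ x) (y *ˢ x′) λ σ → begin
  linear (δ σ) (y *ˢ x)                                  ≡⟨ linear-*ˢ (δ σ) y x ⟩
  linear (λ π → linear (λ τ → δ σ (π ∘ᵐ τ)) x) y         ≡⟨ linear-cong y (λ π → linear-resp-≋ (λ τ → δ σ (π ∘ᵐ τ)) x x′ x≋x′) ⟩
  linear (λ π → linear (λ τ → δ σ (π ∘ᵐ τ)) x′) y        ≡⟨ linear-*ˢ (δ σ) y x′ ⟨
  linear (δ σ) (y *ˢ x′)                                 ∎
  where open ≡-Reasoning

·ˢ-congʳ : ∀ {n} k {x x′ : ℤS n} → x ≋ x′ → (k ·ˢ x) ≋ (k ·ˢ x′)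
·ˢ-congʳ k {x} {x′} x≋x′ = ≋-from-linear (k ·ˢ x) (k ·ˢ x′) λ σ →
  trans (linear-· (δ σ) k x) (trans (cong (k *_) (linear-resp-≋ (δ σ) x x′ x≋x′)) (sym (linear-· (δ σ) k x′)))

d-cong : ∀ {n} (G : SimpleGraph n) {c c′ : Chain G} → (∀ F → c F ≋ c′ F) → ∀ F → d G c F ≋ d G c′ F
d-cong G {c} {c′} c≋c′ F = ≋-from-linear (d G c F) (d G c′ F) λ σ →
  trans (linear-d G (δ σ) c F) (trans (∑-cong (allFin (#E G)) (term σ)) (sym (linear-d G (δ σ) c′ F)))
  where
  term : ∀ σ e → (if Vec.lookup F e then 0ℤ else sign (countBelow F e) * linear (δ σ) (c (F [ e ]≔ true)))
               ≡ (if Vec.lookup F e then 0ℤ else sign (countBelow F e) * linear (δ σ) (c′ (F [ e ]≔ true)))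
  term σ e = cong (λ v → if Vec.lookup F e then 0ℤ else sign (countBelow F e) * v)
                  (linear-resp-≋ (δ σ) (c (F [ e ]≔ true)) (c′ (F [ e ]≔ true)) (c≋c′ (F [ e ]≔ true)))

∣-∑ : ∀ {A : Set} {k} xs (f : A → ℤ) → (∀ x → k ∣ f x) → k ∣ ∑ xs f
∣-∑ {k = k} []       f k∣f = divides 0ℤ (sym (ℤ.*-zeroˡ k))
∣-∑ (x ∷ xs) f k∣f = ∣m∣n⇒∣m+n (k∣f x) (∣-∑ xs f k∣f)

∣-linear : ∀ {n k} (f : Map n → ℤ) x → (∀ σ → k ∣ f σ) → k ∣ linear f x
∣-linear f x k∣f = ∣-∑ x _ (λ t → ∣n⇒∣m*n (proj₁ t) (k∣f (proj₂ t)))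

2∣x+x : ∀ x → + 2 ∣ x + x
2∣x+x x = divides x (solve 1 (λ x → x :+ x := x :* con (+ 2)) refl x)
  where open +-*-Solver

2∣-negˡ : ∀ x y → + 2 ∣ x + y → + 2 ∣ - x + y
2∣-negˡ x y 2∣x+y = subst (+ 2 ∣_) (solve 2 (λ x y → (x :+ y) :- (x :+ x) := :- x :+ y) refl x y)
  (∣m∣n⇒∣m-n 2∣x+y (2∣x+x x))
  where open +-*-Solver

2∣-negʳ : ∀ x y → + 2 ∣ x + y → + 2 ∣ x + - y
2∣-negʳ x y 2∣x+y = subst (+ 2 ∣_) (+-comm (- y) x) (2∣-negˡ y x (subst (+ 2 ∣_) (+-comm x y) 2∣x+y))

sign≡±1 : ∀ m → sign m ≡ 1ℤ ⊎ sign m ≡ - 1ℤ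
sign≡±1 ℕ.zero    = inj₁ refl
sign≡±1 (ℕ.suc m) with sign≡±1 m
... | inj₁ s≡1  = inj₂ (cong (- 1ℤ *_) s≡1)
... | inj₂ s≡-1 = inj₁ (cong (- 1ℤ *_) s≡-1)

sign-*-cases : ∀ m x → sign m * x ≡ x ⊎ sign m * x ≡ - x
sign-*-cases m x with sign≡±1 m
... | inj₁ s≡1  = inj₁ (trans (cong (_* x) s≡1) (*-identityˡ x))
... | inj₂ s≡-1 = inj₂ (trans (cong (_* x) s≡-1) (ℤ.-1*i≡-i x))

2∣-signed : ∀ m m′ {x y} → + 2 ∣ x + y → + 2 ∣ sign m * x + sign m′ * y
2∣-signed m m′ {x} {y} 2∣x+y with sign-*-cases m x | sign-*-cases m′ y
... | inj₁ sx≡x  | inj₁ sy≡y  = subst (+ 2 ∣_) (sym (cong₂ _+_ sx≡x sy≡y)) 2∣x+y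
... | inj₂ sx≡-x | inj₁ sy≡y  = subst (+ 2 ∣_) (sym (cong₂ _+_ sx≡-x sy≡y)) (2∣-negˡ x y 2∣x+y)
... | inj₁ sx≡x  | inj₂ sy≡-y = subst (+ 2 ∣_) (sym (cong₂ _+_ sx≡x sy≡-y)) (2∣-negʳ x y 2∣x+y)
... | inj₂ sx≡-x | inj₂ sy≡-y = subst (+ 2 ∣_) (sym (cong₂ _+_ sx≡-x sy≡-y)) (2∣-negˡ x (- y) (2∣-negʳ x y 2∣x+y))

∑∑-even : ∀ {A : Set} xs (t : A → A → ℤ) → (∀ i → + 2 ∣ t i i) → (∀ i j → + 2 ∣ t i j + t j i) →
          + 2 ∣ ∑ xs (λ i → ∑ xs (t i))
∑∑-even []       t diagonal pairs = 2∣x+x 0ℤ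
∑∑-even (x ∷ xs) t diagonal pairs = subst (+ 2 ∣_) (sym regroup)
  (∣m∣n⇒∣m+n (diagonal x) (∣m∣n⇒∣m+n (subst (+ 2 ∣_) (∑-+ xs (t x) (λ i → t i x)) (∣-∑ xs _ (pairs x)))
                                     (∑∑-even xs t diagonal pairs)))
  where
  open ≡-Reasoning
  rest = ∑ xs (λ i → ∑ xs (t i))
  regroup : ∑ (x ∷ xs) (λ i → ∑ (x ∷ xs) (t i)) ≡ t x x + ((∑ xs (t x) + ∑ xs (λ i → t i x)) + rest)
  regroup = begin
      (t x x + ∑ xs (t x)) + ∑ xs (λ i → t i x + ∑ xs (t i))
    ≡⟨ cong (_+_ (t x x + ∑ xs (t x))) (∑-+ xs _ _) ⟩
      (t x x + ∑ xs (t x)) + (∑ xs (λ i → t i x) + rest)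
    ≡⟨ +-assoc (t x x) _ _ ⟩
      t x x + (∑ xs (t x) + (∑ xs (λ i → t i x) + rest))
    ≡⟨ cong (_+_ (t x x)) (sym (+-assoc (∑ xs (t x)) _ _)) ⟩
      t x x + ((∑ xs (t x) + ∑ xs (λ i → t i x)) + rest) ∎

-- Young subgroups

youngPerms : ∀ {n} → (Fin n → Fin n) → List (Map n)
youngPerms {n} label = filterᵇ isPerm (vecsWhere n (λ u w → label u ==ᶠ label w))

-- Relabels the class of one endpoint of each edge of F by the label of the other. Nothing is proved
-- about it: every labelling used below is checked with isComponentLabelling?.
componentLabels : ∀ {m n} → (Fin m → Fin n × Fin n) → Subset m → Fin n → Fin n
componentLabels {m} {n} ends F = Vec.lookup (List.foldr merge (Vec.tabulate id) (allFin m))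
  where
  merge : Fin m → Vec (Fin n) n → Vec (Fin n) n
  merge e current = if Vec.lookup F e then Vec.map (λ l → if l ==ᶠ old then new else l) current else current
    where
    new = Vec.lookup current (proj₁ (ends e))
    old = Vec.lookup current (proj₂ (ends e))

module _ {n} (G : SimpleGraph n) (F : EdgeSet G) where

  IsComponentLabelling : (Fin n → Fin n) → Set
  IsComponentLabelling label = ∀ u v →
    (T (adjF G F u v) → label u ≡ label v) × (label u ≡ label v → T (sameComp G F u v))

  isComponentLabelling? : ∀ label → Dec (IsComponentLabelling label)
  isComponentLabelling? label = all? λ u → all? λ v →
    (T? (adjF G F u v) →-dec label u ≟ᶠ label v) ×-dec (label u ≟ᶠ label v →-dec T? (sameComp G F u v))

  module _ {label} (isLabelling : IsComponentLabelling label) where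

    reach⇒same-label : ∀ k u v → T (reach G F k u v) → label u ≡ label v
    reach⇒same-label ℕ.zero    u v r with u ≟ᶠ v
    ... | yes u≡v = cong label u≡v
    reach⇒same-label (ℕ.suc k) u v r with reach G F k u v in reach-k
    ... | true  = reach⇒same-label k u v (subst T (sym reach-k) tt)
    ... | false with w , step ← satisfied (any⁻ (λ w → reach G F k u w ∧ adjF G F w v) (allFin n) r)
                with reach G F k u w in reach-uw
    ...   | true = trans (reach⇒same-label k u w (subst T (sym reach-uw) tt)) (proj₁ (isLabelling w v) step)

    sameComp≡same-label : ∀ u v → sameComp G F u v ≡ (label u ==ᶠ label v)
    sameComp≡same-label u v with label u ≟ᶠ label v
    ... | yes same = Equivalence.to T-≡ (proj₂ (isLabelling u v) same)
    ... | no  diff with sameComp G F u v in conn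
    ...   | false = refl
    ...   | true  = contradiction (reach⇒same-label n u v (subst T (sym conn) tt)) diff

    a≋ones-youngPerms : a G F ≋ ones (youngPerms label)
    a≋ones-youngPerms = ≋-from-linear (a G F) (ones (youngPerms label)) λ σ → begin
        linear (δ σ) (a G F)
      ≡⟨ linear-δ-ones-filter σ (inYoung G F) (allMaps n) ⟩
        ∑ (allMaps n) (λ τ → if σ ==ᵛ τ then indicator (inYoung G F τ) else 0ℤ)
      ≡⟨ ∑-allVecs-δ n σ (indicator ∘ inYoung G F) ⟩
        indicator (inYoung G F σ)
      ≡⟨ cong indicator (inYoung≡ σ) ⟩
        indicator (isPerm σ ∧ pointwise P σ)
      ≡⟨ if-∧ (isPerm σ) (pointwise P σ) ⟩
        (if pointwise P σ then indicator (isPerm σ) else 0ℤ)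
      ≡⟨ ∑-vecsWhere-δ n P σ (indicator ∘ isPerm) ⟨
        ∑ (vecsWhere n P) (λ τ → if σ ==ᵛ τ then indicator (isPerm τ) else 0ℤ)
      ≡⟨ linear-δ-ones-filter σ isPerm (vecsWhere n P) ⟨
        linear (δ σ) (ones (youngPerms label)) ∎
      where
      open ≡-Reasoning
      P : Fin n → Fin n → Bool
      P u w = label u ==ᶠ label w
      inYoung≡ : ∀ σ → inYoung G F σ ≡ isPerm σ ∧ pointwise P σ
      inYoung≡ σ = cong (isPerm σ ∧_) (all-cong (allFin n) (λ u → sameComp≡same-label u (Vec.lookup σ u)))
      if-∧ : ∀ b c → indicator (b ∧ c) ≡ (if c then indicator b else 0ℤ)
      if-∧ true  true  = refl
      if-∧ true  false = refl
      if-∧ false true  = refl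
      if-∧ false false = refl

-- Deciding equality in ℤ[𝔖ₙ]

-- A trie indexed by the images of a map collects the coefficients of an element of ℤ[𝔖ₙ] sparsely, so
-- that x ≋ y is decided without running through all nⁿ maps.
data Trie (n : ℕ) : ℕ → Set where
  leaf  : ℤ → Trie n ℕ.zero
  empty : ∀ {k} → Trie n (ℕ.suc k)
  node  : ∀ {k} → Vec (Trie n k) n → Trie n (ℕ.suc k)

emptyᵗ : ∀ {n} k → Trie n k
emptyᵗ ℕ.zero    = leaf 0ℤ
emptyᵗ (ℕ.suc k) = empty

lookupᵗ : ∀ {n k} → Trie n k → Vec (Fin n) k → ℤ
lookupᵗ (leaf x)  []      = x
lookupᵗ empty     _       = 0ℤ
lookupᵗ (node ts) (i ∷ v) = lookupᵗ (Vec.lookup ts i) v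

insertᵗ : ∀ {n k} → Vec (Fin n) k → ℤ → Trie n k → Trie n k
insertᵗ []      c (leaf x)  = leaf (c + x)
insertᵗ {n} {ℕ.suc k} (i ∷ v) c empty = node (Vec.replicate n (emptyᵗ k) [ i ]≔ insertᵗ v c (emptyᵗ k))
insertᵗ (i ∷ v) c (node ts) = node (ts [ i ]≔ insertᵗ v c (Vec.lookup ts i))

lookup-emptyᵗ : ∀ {n} k (w : Vec (Fin n) k) → lookupᵗ (emptyᵗ k) w ≡ 0ℤ
lookup-emptyᵗ ℕ.zero    [] = refl
lookup-emptyᵗ (ℕ.suc k) w  = refl

lookup-insertᵗ : ∀ {n k} (v : Vec (Fin n) k) c (t : Trie n k) w →
                 lookupᵗ (insertᵗ v c t) w ≡ (if v ==ᵛ w then c else 0ℤ) + lookupᵗ t w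
lookup-insertᵗ [] c (leaf x) [] = refl
lookup-insertᵗ {n} {ℕ.suc k} (i ∷ v) c empty (j ∷ w) with i ≟ᶠ j
... | yes refl = trans (cong (λ t → lookupᵗ t w) (lookup∘update i (Vec.replicate n (emptyᵗ k)) _))
                   (trans (lookup-insertᵗ v c (emptyᵗ k) w) (cong (_+_ (if v ==ᵛ w then c else 0ℤ)) (lookup-emptyᵗ k w)))
... | no i≢j   = trans (cong (λ t → lookupᵗ t w) (lookup∘update′ (i≢j ∘ sym) (Vec.replicate n (emptyᵗ k)) _))
                   (trans (cong (λ t → lookupᵗ t w) (lookup-replicate j (emptyᵗ k))) (lookup-emptyᵗ k w))
lookup-insertᵗ (i ∷ v) c (node ts) (j ∷ w) with i ≟ᶠ j
... | yes refl = trans (cong (λ t → lookupᵗ t w) (lookup∘update i ts _)) (lookup-insertᵗ v c (Vec.lookup ts i) w)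
... | no i≢j   = trans (cong (λ t → lookupᵗ t w) (lookup∘update′ (i≢j ∘ sym) ts _)) (sym (+-identityˡ _))

fromℤS : ∀ {n} → ℤS n → Trie n n
fromℤS {n} []            = emptyᵗ n
fromℤS     ((k , σ) ∷ x) = insertᵗ σ k (fromℤS x)

lookup-fromℤS : ∀ {n} (x : ℤS n) π → lookupᵗ (fromℤS x) π ≡ linear (δ π) x
lookup-fromℤS {n} []            π = lookup-emptyᵗ n π
lookup-fromℤS     ((k , σ) ∷ x) π = trans (lookup-insertᵗ σ k (fromℤS x) π) (cong₂ _+_ (scaled (σ ==ᵛ π)) (lookup-fromℤS x π))
  where
  scaled : ∀ b → (if b then k else 0ℤ) ≡ k * indicator b
  scaled true  = sym (*-identityʳ k)
  scaled false = sym (*-zeroʳ k)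

mutual
  allZero : ∀ {n k} → Trie n k → Bool
  allZero (leaf x)  = does (x ℤ.≟ 0ℤ)
  allZero empty     = true
  allZero (node ts) = allZeroᵛ ts

  allZeroᵛ : ∀ {n k m} → Vec (Trie n k) m → Bool
  allZeroᵛ []       = true
  allZeroᵛ (t ∷ ts) = allZero t ∧ allZeroᵛ ts

mutual
  allZero-sound : ∀ {n k} (t : Trie n k) → T (allZero t) → ∀ w → lookupᵗ t w ≡ 0ℤ
  allZero-sound (leaf x) zero? [] with x ℤ.≟ 0ℤ
  ... | yes x≡0 = x≡0
  allZero-sound empty     _     w       = refl
  allZero-sound (node ts) zero? (i ∷ w) = allZeroᵛ-sound ts zero? i w

  allZeroᵛ-sound : ∀ {n k m} (ts : Vec (Trie n k) m) → T (allZeroᵛ ts) → ∀ i w → lookupᵗ (Vec.lookup ts i) w ≡ 0ℤ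
  allZeroᵛ-sound (t ∷ ts) zero? zero    w = allZero-sound t (proj₁ (Equivalence.to (T-∧ {allZero t}) zero?)) w
  allZeroᵛ-sound (t ∷ ts) zero? (suc i) w = allZeroᵛ-sound ts (proj₂ (Equivalence.to (T-∧ {allZero t}) zero?)) i w

_==ˢ_ : ∀ {n} → ℤS n → ℤS n → Bool
x ==ˢ y = allZero (fromℤS (x ++ (- 1ℤ) ·ˢ y))

==ˢ-sound : ∀ {n} (x y : ℤS n) → T (x ==ˢ y) → x ≋ y
==ˢ-sound x y x==y = ≋-from-linear x y λ π → ℤ.i-j≡0⇒i≡j (linear (δ π) x) (linear (δ π) y) (begin
    linear (δ π) x - linear (δ π) y               ≡⟨ cong (_+_ (linear (δ π) x)) (ℤ.-1*i≡-i _) ⟨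
    linear (δ π) x + - 1ℤ * linear (δ π) y        ≡⟨ cong (_+_ (linear (δ π) x)) (linear-· (δ π) (- 1ℤ) y) ⟨
    linear (δ π) x + linear (δ π) ((- 1ℤ) ·ˢ y)   ≡⟨ linear-++ (δ π) x ((- 1ℤ) ·ˢ y) ⟨
    linear (δ π) (x ++ (- 1ℤ) ·ˢ y)               ≡⟨ lookup-fromℤS (x ++ (- 1ℤ) ·ˢ y) π ⟨
    lookupᵗ (fromℤS (x ++ (- 1ℤ) ·ˢ y)) π         ≡⟨ allZero-sound (fromℤS (x ++ (- 1ℤ) ·ˢ y)) x==y π ⟩
    0ℤ                                            ∎)
  where open ≡-Reasoning

∀-Subset? : ∀ {m} {P : Subset m → Set} → (∀ F → Dec (P F)) → Dec (∀ F → P F)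
∀-Subset? {ℕ.zero}  P? = map′ (λ P[] → λ { [] → P[] }) (λ ∀P → ∀P []) (P? [])
∀-Subset? {ℕ.suc m} P? = map′ (λ (Pin , Pout) → λ { (true ∷ F) → Pin F ; (false ∷ F) → Pout F })
  (λ ∀P → ∀P ∘ (true ∷_) , ∀P ∘ (false ∷_)) (∀-Subset? (P? ∘ (true ∷_)) ×-dec ∀-Subset? (P? ∘ (false ∷_)))

module _ {m n : ℕ} where

  select : List (Subset m × ℤS n) → Subset m → ℤS n
  select table F = concatMap (λ entry → if does (≡-dec _≟ᵇ_ F (proj₁ entry)) then proj₂ entry else []) table

  select-cases : ∀ table F → select table F ≡ [] ⊎ Any (λ entry → proj₁ entry ≡ F) table
  select-cases []                 F = inj₁ refl
  select-cases ((F′ , y) ∷ table) F with ≡-dec _≟ᵇ_ F F′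
  ... | yes F≡F′ = inj₂ (here (sym F≡F′))
  ... | no  _    = Sum.map₂ there (select-cases table F)

  InℤS-select : ∀ table F → All (InℤS ∘ proj₂) table → InℤS (select table F)
  InℤS-select []                 F []             = []
  InℤS-select ((F′ , y) ∷ table) F (y-perm ∷ rest) with does (≡-dec _≟ᵇ_ F F′)
  ... | true  = ++⁺ y-perm (InℤS-select table F rest)
  ... | false = InℤS-select table F rest

  select-*ˢ-cong : ∀ table {A B : Subset m → ℤS n} → All (λ entry → A (proj₁ entry) ≋ B (proj₁ entry)) table →
                   ∀ F → (select table F *ˢ A F) ≋ (select table F *ˢ B F)
  select-*ˢ-cong table {A} {B} agree F with select-cases table F
  ... | inj₁ none = subst (λ y → (y *ˢ A F) ≋ (y *ˢ B F)) (sym none) (λ _ → refl)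
  ... | inj₂ key with lookupAny agree key
  ...   | A≋B , key≡F = *ˢ-congʳ (select table F) (subst (λ F′ → A F′ ≋ B F′) key≡F A≋B)

module _ {n} (G : SimpleGraph n) where

  tableChain : List (EdgeSet G × ℤS n) → Chain G
  tableChain table F = select table F *ˢ a G F

  tableChain-isChain : ∀ k table → All (λ entry → ∣ proj₁ entry ∣ ≡ k × InℤS (proj₂ entry)) table →
                       IsChain G k (tableChain table)
  tableChain-isChain k table entries-ok F =
    (λ _ → select table F , InℤS-select table F (All.map proj₂ entries-ok) , λ _ → refl) , off-degree
    where
    off-degree : ∣ F ∣ ≢ k → tableChain table F ≋ 0ˢ
    off-degree ∣F∣≢k with select-cases table F
    ... | inj₁ none = subst (λ y → (y *ˢ a G F) ≋ 0ˢ) (sym none) (λ _ → refl)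
    ... | inj₂ key with lookupAny entries-ok key
    ...   | (∣key∣≡k , _) , key≡F = contradiction (subst (λ F′ → ∣ F′ ∣ ≡ k) key≡F ∣key∣≡k) ∣F∣≢k

-- The pairing functional

doubleton : ∀ {m} → Fin m → Fin m → Subset m
doubleton x y = ⁅ x ⁆ [ y ]≔ true

⊥[x]≔true≡⁅x⁆ : ∀ {m} (x : Fin m) → ⊥ [ x ]≔ true ≡ ⁅ x ⁆
⊥[x]≔true≡⁅x⁆ zero    = refl
⊥[x]≔true≡⁅x⁆ (suc x) = cong (false ∷_) (⊥[x]≔true≡⁅x⁆ x)

doubleton-comm : ∀ {m} (x y : Fin m) → doubleton x y ≡ doubleton y x
doubleton-comm zero    zero    = refl
doubleton-comm zero    (suc y) = cong (true ∷_) (⊥[x]≔true≡⁅x⁆ y)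
doubleton-comm (suc x) zero    = cong (true ∷_) (sym (⊥[x]≔true≡⁅x⁆ x))
doubleton-comm (suc x) (suc y) = cong (false ∷_) (doubleton-comm x y)

∣doubleton∣≡2 : ∀ {m} {x y : Fin m} → x ≢ y → ∣ doubleton x y ∣ ≡ 2
∣doubleton∣≡2 {x = zero}  {zero}  x≢y = contradiction refl x≢y
∣doubleton∣≡2 {x = zero}  {suc y} x≢y = cong ℕ.suc (trans (cong ∣_∣ (⊥[x]≔true≡⁅x⁆ y)) (∣⁅x⁆∣≡1 y))
∣doubleton∣≡2 {x = suc x} {zero}  x≢y = cong ℕ.suc (∣⁅x⁆∣≡1 x)
∣doubleton∣≡2 {x = suc x} {suc y} x≢y = ∣doubleton∣≡2 (x≢y ∘ cong suc)

lookup-⁅x⁆-self : ∀ {m} (x : Fin m) → Vec.lookup ⁅ x ⁆ x ≡ true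
lookup-⁅x⁆-self x = []=⇒lookup (x∈⁅x⁆ x)

lookup-⁅x⁆-other : ∀ {m} {x y : Fin m} → x ≢ y → Vec.lookup ⁅ x ⁆ y ≡ false
lookup-⁅x⁆-other x≢y = ¬-not (x≢y ∘ sym ∘ x∈⁅y⁆⇒x≡y _ ∘ lookup⇒[]= _ _)

module PairingFunctional {n} (G : SimpleGraph n) (h : Fin (#E G) → Map n → ℤ) where

  Φ : Chain G → ℤ
  Φ w = ∑ (allFin (#E G)) (λ e → linear (h e) (w ⁅ e ⁆))

  Φ-resp-≋ : ∀ w w′ → (∀ F → w F ≋ w′ F) → Φ w ≡ Φ w′
  Φ-resp-≋ w w′ w≋w′ = ∑-cong (allFin (#E G)) (λ e → linear-resp-≋ (h e) (w ⁅ e ⁆) (w′ ⁅ e ⁆) (w≋w′ ⁅ e ⁆))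

  Φ∘d-even : (∀ {e e′} → e ≢ e′ → ∀ y → + 2 ∣ linear (λ σ → h e σ + h e′ σ) (y *ˢ a G (doubleton e e′))) →
             ∀ z → IsChain G 2 z → + 2 ∣ Φ (d G z)
  Φ∘d-even pairs-even z z∈C₂ = subst (+ 2 ∣_) (sym Φ∘d≡∑∑) (∑∑-even (allFin (#E G)) term diagonal pairs)
    where
    signed term : Fin (#E G) → Fin (#E G) → ℤ
    signed e e′ = sign (countBelow ⁅ e ⁆ e′) * linear (h e) (z (doubleton e e′))
    term e e′ = if Vec.lookup ⁅ e ⁆ e′ then 0ℤ else signed e e′

    Φ∘d≡∑∑ : Φ (d G z) ≡ ∑ (allFin (#E G)) (λ e → ∑ (allFin (#E G)) (term e))
    Φ∘d≡∑∑ = ∑-cong (allFin (#E G)) (λ e → linear-d G (h e) z ⁅ e ⁆)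

    diagonal : ∀ e → + 2 ∣ term e e
    diagonal e = subst (λ b → + 2 ∣ (if b then 0ℤ else signed e e)) (sym (lookup-⁅x⁆-self e)) (2∣x+x 0ℤ)

    term-≢ : ∀ {e e′} → e ≢ e′ → term e e′ ≡ signed e e′
    term-≢ {e} {e′} e≢e′ = cong (λ b → if b then 0ℤ else signed e e′) (lookup-⁅x⁆-other e≢e′)

    pair-sum-even : ∀ {e e′} → e ≢ e′ → + 2 ∣ linear (h e) (z (doubleton e e′)) + linear (h e′) (z (doubleton e e′))
    pair-sum-even {e} {e′} e≢e′ with proj₁ (z∈C₂ (doubleton e e′)) (∣doubleton∣≡2 e≢e′)
    ... | y , _ , z≋ya = subst (+ 2 ∣_)
      (trans (linear-resp-≋ (λ σ → h e σ + h e′ σ) (y *ˢ a G (doubleton e e′)) (z (doubleton e e′)) (λ σ → sym (z≋ya σ)))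
             (linear-+ (h e) (h e′) (z (doubleton e e′))))
      (pairs-even e≢e′ y)

    pairs : ∀ e e′ → + 2 ∣ term e e′ + term e′ e
    pairs e e′ with e ≟ᶠ e′
    ... | yes refl  = 2∣x+x (term e e)
    ... | no  e≢e′  = subst (+ 2 ∣_)
      (sym (cong₂ _+_ (term-≢ e≢e′) (trans (term-≢ (e≢e′ ∘ sym))
                                          (cong (λ D → sign (countBelow ⁅ e′ ⁆ e) * linear (h e′) (z D)) (doubleton-comm e′ e)))))
      (2∣-signed (countBelow ⁅ e ⁆ e′) (countBelow ⁅ e′ ⁆ e) (pair-sum-even e≢e′))

preimage : ∀ {n} → (Fin n → Bool) → Map n → Vec Bool n
preimage S σ = Vec.map S σ

permute : ∀ {n} → Map n → Vec Bool n → Vec Bool n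
permute τ β = Vec.tabulate (λ i → Vec.lookup β (Vec.lookup τ i))

preimage-∘ᵐ : ∀ {n} (S : Fin n → Bool) σ τ → preimage S (σ ∘ᵐ τ) ≡ permute τ (preimage S σ)
preimage-∘ᵐ S σ τ = trans (sym (tabulate-∘ S (λ i → Vec.lookup σ (Vec.lookup τ i))))
  (tabulate-cong (λ i → sym (lookup-map (Vec.lookup τ i) S σ)))

2∣-linear-*ˢ-ones : ∀ {n} (S : Fin n → Bool) (H : Vec Bool n → ℤ) (Y : List (Map n)) →
                  (∀ β → + 2 ∣ ∑ Y (λ τ → H (permute τ β))) → ∀ y → + 2 ∣ linear (H ∘ preimage S) (y *ˢ ones Y)
2∣-linear-*ˢ-ones S H Y orbit-even y = subst (+ 2 ∣_) (sym (linear-*ˢ (H ∘ preimage S) y (ones Y)))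
  (∣-linear _ y λ σ → subst (+ 2 ∣_)
    (sym (trans (linear-ones _ Y) (∑-cong Y (λ τ → cong H (preimage-∘ᵐ S σ τ)))))
    (orbit-even (preimage S σ)))

-- The certificate for K₃,₃

v1 v2 v3 v4 v5 v6 : Fin 6
v1 = # 0
v2 = # 1
v3 = # 2
v4 = # 3
v5 = # 4
v6 = # 5

e14 e15 e16 e24 e25 e26 e34 e35 e36 : Fin 9
e14 = # 0
e15 = # 1
e16 = # 2
e24 = # 3
e25 = # 4
e26 = # 5
e34 = # 6
e35 = # 7
e36 = # 8

endpoints : Fin 9 → Fin 6 × Fin 6
endpoints = Vec.lookup ( (v1 , v4) ∷ (v1 , v5) ∷ (v1 , v6)
                       ∷ (v2 , v4) ∷ (v2 , v5) ∷ (v2 , v6)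
                       ∷ (v3 , v4) ∷ (v3 , v5) ∷ (v3 , v6) ∷ [])

perm : Fin 6 → Fin 6 → Fin 6 → Fin 6 → Fin 6 → Fin 6 → Map 6
perm σ1 σ2 σ3 σ4 σ5 σ6 = σ1 ∷ σ2 ∷ σ3 ∷ σ4 ∷ σ5 ∷ σ6 ∷ []

infix 6 ⊕_ ⊖_
⊕_ ⊖_ : Map 6 → ℤ × Map 6
⊕ σ = 1ℤ , σ
⊖ σ = - 1ℤ , σ

cTable : List (Subset 9 × ℤS 6)
cTable =
  (⁅ e14 ⁆ ,
     ⊕ perm v4 v5 v3 v6 v2 v1 ∷ ⊖ perm v2 v5 v3 v4 v1 v6 ∷ ⊕ perm v2 v5 v6 v3 v1 v4 ∷ ⊖ perm v2 v6 v3 v4 v1 v5 ∷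
     ⊕ perm v2 v4 v6 v3 v1 v5 ∷ ⊕ perm v2 v4 v6 v3 v5 v1 ∷ ⊕ perm v3 v2 v6 v4 v5 v1 ∷ ⊕ perm v2 v5 v6 v3 v4 v1 ∷
     ⊕ perm v3 v5 v6 v4 v2 v1 ∷ ⊕ perm v4 v1 v3 v6 v2 v5 ∷ []) ∷
  (⁅ e15 ⁆ ,
     ⊖ perm v2 v5 v3 v4 v6 v1 ∷ ⊖ perm v1 v2 v6 v3 v5 v4 ∷ ⊖ perm v4 v2 v6 v3 v5 v1 ∷ ⊖ perm v1 v4 v3 v6 v5 v2 ∷
     ⊖ perm v1 v5 v3 v2 v6 v4 ∷ ⊖ perm v3 v5 v6 v2 v4 v1 ∷ ⊖ perm v1 v5 v6 v2 v3 v4 ∷ ⊖ perm v1 v6 v3 v5 v4 v2 ∷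
     ⊖ perm v2 v1 v3 v6 v4 v5 ∷ ⊖ perm v2 v4 v3 v1 v6 v5 ∷ ⊖ perm v5 v4 v3 v1 v6 v2 ∷ ⊖ perm v2 v4 v6 v1 v3 v5 ∷
     ⊕ perm v1 v2 v6 v4 v3 v5 ∷ ⊕ perm v1 v5 v6 v3 v4 v2 ∷ ⊕ perm v4 v2 v3 v5 v6 v1 ∷ ⊖ perm v2 v1 v3 v4 v6 v5 ∷
     ⊖ perm v2 v5 v6 v4 v3 v1 ∷ ⊖ perm v2 v4 v6 v5 v3 v1 ∷ ⊖ perm v1 v5 v6 v3 v2 v4 ∷ []) ∷
  (⁅ e16 ⁆ ,
     ⊕ perm v5 v4 v3 v1 v2 v6 ∷ ⊕ perm v3 v4 v6 v1 v2 v5 ∷ ⊕ perm v4 v5 v3 v2 v1 v6 ∷ ⊖ perm v2 v5 v6 v3 v1 v4 ∷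
     ⊕ perm v2 v6 v3 v5 v1 v4 ∷ ⊖ perm v1 v2 v3 v5 v4 v6 ∷ ⊖ perm v1 v2 v6 v4 v3 v5 ∷ ⊖ perm v1 v2 v6 v5 v4 v3 ∷
     ⊖ perm v1 v4 v6 v3 v5 v2 ∷ ⊖ perm v1 v5 v6 v3 v4 v2 ∷ ⊖ perm v2 v1 v3 v4 v5 v6 ∷ ⊖ perm v2 v4 v6 v3 v1 v5 ∷
     ⊖ perm v4 v2 v3 v6 v1 v5 ∷ ⊕ perm v1 v4 v6 v5 v3 v2 ∷ ⊖ perm v2 v1 v6 v3 v4 v5 ∷ []) ∷
  (⁅ e24 ⁆ ,
     ⊖ perm v3 v2 v6 v4 v1 v5 ∷ ⊖ perm v3 v2 v6 v4 v5 v1 ∷ ⊖ perm v4 v2 v3 v5 v6 v1 ∷ ⊕ perm v4 v2 v3 v6 v1 v5 ∷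
     ⊖ perm v2 v5 v3 v6 v1 v4 ∷ ⊖ perm v5 v1 v6 v4 v3 v2 ∷ ⊕ perm v6 v1 v3 v4 v5 v2 ∷ []) ∷
  (⁅ e25 ⁆ ,
     ⊕ perm v2 v1 v3 v4 v6 v5 ∷ ⊕ perm v1 v4 v3 v5 v6 v2 ∷ ⊕ perm v3 v2 v6 v5 v4 v1 ∷ ⊕ perm v1 v2 v6 v3 v5 v4 ∷
     ⊕ perm v2 v1 v3 v4 v5 v6 ∷ []) ∷
  (⁅ e26 ⁆ ,
     ⊕ perm v5 v1 v6 v3 v4 v2 ∷ ⊕ perm v5 v2 v6 v3 v1 v4 ∷ ⊕ perm v5 v1 v6 v4 v3 v2 ∷ ⊕ perm v5 v2 v3 v6 v1 v4 ∷ []) ∷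
  (⁅ e34 ⁆ ,
     ⊕ perm v2 v5 v3 v6 v1 v4 ∷ ⊕ perm v4 v5 v2 v6 v3 v1 ∷ ⊕ perm v4 v5 v2 v3 v6 v1 ∷ ⊕ perm v1 v4 v3 v6 v5 v2 ∷
     ⊕ perm v2 v1 v3 v6 v4 v5 ∷ []) ∷
  (⁅ e35 ⁆ ,
     ⊖ perm v4 v5 v2 v3 v6 v1 ∷ ⊖ perm v4 v5 v2 v6 v3 v1 ∷ ⊕ perm v1 v5 v3 v2 v6 v4 ∷ ⊕ perm v2 v4 v3 v1 v6 v5 ∷
     ⊕ perm v2 v5 v3 v4 v6 v1 ∷ ⊖ perm v1 v4 v3 v5 v6 v2 ∷ ⊕ perm v5 v4 v3 v1 v6 v2 ∷ []) ∷
  (⁅ e36 ⁆ ,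
     ⊖ perm v5 v4 v3 v1 v2 v6 ∷ ⊕ perm v1 v2 v3 v5 v4 v6 ∷ []) ∷
  []

zTable : List (Subset 9 × ℤS 6)
zTable =
  (doubleton e14 e15 ,
     ⊕ perm v1 v4 v2 v3 v6 v5 ∷ ⊕ perm v2 v3 v6 v4 v5 v1 ∷ ⊕ perm v2 v4 v3 v5 v6 v1 ∷ ⊕ perm v2 v5 v1 v3 v6 v4 ∷
     ⊕ perm v2 v5 v3 v4 v6 v1 ∷ ⊕ perm v3 v4 v2 v5 v6 v1 ∷ ⊕ perm v3 v5 v2 v4 v6 v1 ∷ ⊕ perm v4 v1 v3 v5 v6 v2 ∷ []) ∷
  (doubleton e14 e16 ,
     ⊕ perm v1 v4 v3 v5 v2 v6 ∷ ⊕ perm v1 v4 v6 v3 v2 v5 ∷ ⊕ perm v2 v3 v6 v4 v1 v5 ∷ ⊕ perm v2 v5 v3 v4 v1 v6 ∷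
     ⊖ perm v2 v5 v6 v3 v1 v4 ∷ ⊕ perm v2 v6 v3 v4 v1 v5 ∷ []) ∷
  (doubleton e14 e24 ,
     ⊖ perm v2 v3 v6 v4 v1 v5 ∷ ⊖ perm v2 v3 v6 v4 v5 v1 ∷ ⊖ perm v2 v3 v6 v5 v1 v4 ∷ ⊖ perm v2 v3 v6 v5 v4 v1 ∷
     ⊖ perm v2 v4 v3 v5 v6 v1 ∷ ⊕ perm v2 v4 v3 v6 v1 v5 ∷ ⊖ perm v2 v5 v3 v6 v1 v4 ∷ ⊖ perm v4 v5 v3 v6 v2 v1 ∷ []) ∷
  (doubleton e14 e25 ,
     ⊖ perm v3 v1 v6 v5 v4 v2 ∷ ⊖ perm v3 v2 v6 v4 v5 v1 ∷ ⊖ perm v4 v1 v3 v5 v6 v2 ∷ ⊖ perm v4 v1 v3 v6 v2 v5 ∷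
     ⊖ perm v4 v1 v3 v6 v5 v2 ∷ ⊖ perm v4 v1 v6 v5 v3 v2 ∷ ⊕ perm v4 v2 v3 v5 v6 v1 ∷ ⊖ perm v4 v2 v6 v5 v3 v1 ∷
     ⊖ perm v5 v1 v3 v6 v4 v2 ∷ []) ∷
  (doubleton e14 e26 ,
     ⊕ perm v3 v1 v6 v5 v4 v2 ∷ ⊕ perm v3 v2 v6 v4 v1 v5 ∷ ⊕ perm v3 v2 v6 v5 v1 v4 ∷ ⊖ perm v4 v1 v3 v6 v2 v5 ∷
     ⊕ perm v4 v1 v6 v5 v3 v2 ∷ ⊕ perm v5 v2 v3 v6 v1 v4 ∷ []) ∷
  (doubleton e14 e34 ,
     ⊖ perm v2 v4 v3 v6 v1 v5 ∷ ⊖ perm v2 v4 v3 v6 v5 v1 ∷ ⊕ perm v2 v5 v3 v6 v1 v4 ∷ ⊖ perm v2 v5 v3 v6 v4 v1 ∷ []) ∷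
  (doubleton e14 e35 ,
     ⊖ perm v1 v4 v2 v3 v6 v5 ∷ ⊖ perm v1 v4 v2 v6 v3 v5 ∷ ⊖ perm v2 v5 v1 v3 v6 v4 ∷ ⊖ perm v2 v5 v1 v6 v3 v4 ∷
     ⊖ perm v3 v4 v2 v5 v6 v1 ∷ ⊖ perm v3 v5 v1 v6 v2 v4 ∷ ⊖ perm v3 v5 v2 v4 v6 v1 ∷ ⊖ perm v4 v5 v2 v6 v3 v1 ∷
     ⊖ perm v5 v4 v2 v6 v3 v1 ∷ []) ∷
  (doubleton e14 e36 ,
     ⊖ perm v1 v4 v3 v5 v2 v6 ∷ ⊕ perm v2 v5 v3 v4 v1 v6 ∷ []) ∷
  (doubleton e15 e16 ,
     ⊕ perm v1 v2 v6 v3 v4 v5 ∷ ⊕ perm v1 v4 v3 v6 v2 v5 ∷ ⊕ perm v1 v5 v3 v2 v4 v6 ∷ ⊕ perm v1 v5 v6 v2 v3 v4 ∷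
     ⊕ perm v1 v6 v3 v5 v2 v4 ∷ ⊕ perm v2 v1 v3 v6 v4 v5 ∷ ⊕ perm v2 v4 v3 v1 v5 v6 ∷ ⊕ perm v2 v4 v6 v1 v3 v5 ∷ []) ∷
  (doubleton e15 e24 ,
     ⊖ perm v1 v2 v3 v4 v6 v5 ∷ ⊕ perm v1 v2 v3 v5 v6 v4 ∷ ⊖ perm v1 v2 v6 v4 v3 v5 ∷ ⊕ perm v1 v2 v6 v5 v3 v4 ∷
     ⊖ perm v1 v3 v6 v4 v5 v2 ∷ ⊖ perm v1 v3 v6 v5 v4 v2 ∷ ⊖ perm v1 v4 v3 v6 v2 v5 ∷ ⊖ perm v1 v5 v3 v6 v2 v4 ∷
     ⊕ perm v2 v4 v3 v5 v6 v1 ∷ ⊖ perm v3 v1 v6 v4 v5 v2 ∷ ⊖ perm v3 v2 v6 v4 v5 v1 ∷ ⊖ perm v4 v2 v3 v5 v6 v1 ∷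
     ⊕ perm v4 v2 v6 v3 v5 v1 ∷ ⊕ perm v5 v1 v3 v4 v6 v2 ∷ []) ∷
  (doubleton e15 e25 ,
     ⊕ perm v1 v2 v3 v4 v6 v5 ∷ ⊖ perm v1 v2 v3 v6 v5 v4 ∷ ⊕ perm v1 v3 v6 v4 v5 v2 ∷ ⊕ perm v1 v3 v6 v5 v4 v2 ∷
     ⊕ perm v1 v4 v3 v5 v6 v2 ∷ ⊕ perm v2 v3 v6 v4 v5 v1 ∷ ⊕ perm v2 v3 v6 v5 v4 v1 ∷ ⊖ perm v2 v4 v3 v5 v6 v1 ∷ []) ∷
  (doubleton e15 e26 ,
     ⊖ perm v1 v2 v3 v5 v6 v4 ∷ ⊕ perm v1 v2 v3 v6 v5 v4 ∷ ⊖ perm v1 v2 v6 v3 v4 v5 ∷ ⊕ perm v1 v2 v6 v3 v5 v4 ∷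
     ⊖ perm v1 v2 v6 v4 v3 v5 ∷ ⊖ perm v1 v2 v6 v5 v3 v4 ∷ ⊕ perm v2 v1 v3 v4 v6 v5 ∷ ⊕ perm v2 v1 v3 v6 v4 v5 ∷
     ⊖ perm v3 v1 v6 v5 v4 v2 ∷ []) ∷
  (doubleton e15 e34 ,
     ⊕ perm v1 v4 v2 v3 v6 v5 ∷ ⊕ perm v1 v4 v2 v6 v3 v5 ∷ ⊖ perm v1 v5 v2 v3 v6 v4 ∷ ⊖ perm v1 v5 v2 v6 v3 v4 ∷
     ⊕ perm v1 v5 v3 v6 v2 v4 ∷ ⊕ perm v3 v4 v2 v6 v5 v1 ∷ ⊕ perm v3 v5 v2 v6 v4 v1 ∷ ⊕ perm v4 v5 v2 v3 v6 v1 ∷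
     ⊕ perm v5 v4 v2 v3 v6 v1 ∷ []) ∷
  (doubleton e15 e35 ,
     ⊕ perm v1 v5 v2 v3 v6 v4 ∷ ⊕ perm v1 v5 v2 v6 v3 v4 ∷ ⊕ perm v1 v5 v3 v2 v6 v4 ∷ ⊕ perm v2 v4 v3 v1 v6 v5 ∷
     ⊕ perm v2 v4 v3 v5 v6 v1 ∷ ⊕ perm v2 v5 v3 v4 v6 v1 ∷ []) ∷
  (doubleton e15 e36 ,
     ⊖ perm v1 v5 v3 v2 v4 v6 ∷ ⊖ perm v2 v4 v3 v1 v5 v6 ∷ []) ∷
  (doubleton e16 e24 ,
     ⊕ perm v1 v2 v3 v4 v6 v5 ∷ ⊕ perm v1 v2 v3 v5 v4 v6 ∷ ⊕ perm v1 v2 v6 v4 v3 v5 ∷ ⊕ perm v1 v2 v6 v5 v4 v3 ∷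
     ⊕ perm v1 v3 v6 v4 v5 v2 ∷ ⊕ perm v1 v3 v6 v5 v4 v2 ∷ ⊕ perm v1 v4 v3 v6 v2 v5 ∷ ⊕ perm v1 v5 v3 v6 v2 v4 ∷
     ⊕ perm v2 v1 v3 v4 v5 v6 ∷ ⊕ perm v2 v1 v6 v4 v5 v3 ∷ ⊕ perm v2 v3 v6 v4 v1 v5 ∷ ⊕ perm v2 v3 v6 v5 v1 v4 ∷
     ⊕ perm v4 v2 v3 v6 v1 v5 ∷ ⊕ perm v4 v2 v6 v3 v1 v5 ∷ []) ∷
  (doubleton e16 e25 ,
     ⊖ perm v1 v2 v3 v4 v6 v5 ∷ ⊕ perm v1 v2 v3 v5 v4 v6 ∷ ⊕ perm v1 v2 v6 v3 v5 v4 ∷ ⊕ perm v1 v2 v6 v5 v4 v3 ∷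
     ⊖ perm v1 v3 v6 v4 v5 v2 ∷ ⊖ perm v1 v3 v6 v5 v4 v2 ∷ ⊕ perm v1 v4 v3 v5 v6 v2 ∷ ⊕ perm v2 v1 v3 v4 v5 v6 ∷
     ⊕ perm v2 v1 v3 v4 v6 v5 ∷ ⊕ perm v2 v1 v3 v6 v4 v5 ∷ ⊕ perm v2 v1 v3 v6 v5 v4 ∷ ⊕ perm v2 v1 v6 v3 v4 v5 ∷
     ⊖ perm v2 v1 v6 v4 v5 v3 ∷ ⊕ perm v4 v1 v3 v6 v2 v5 ∷ []) ∷
  (doubleton e16 e26 ,
     ⊕ perm v1 v2 v6 v3 v4 v5 ∷ ⊕ perm v1 v2 v6 v4 v3 v5 ∷ []) ∷
  (doubleton e16 e34 ,
     ⊖ perm v1 v4 v2 v3 v6 v5 ∷ ⊖ perm v1 v4 v2 v6 v3 v5 ∷ ⊕ perm v1 v4 v3 v6 v5 v2 ∷ ⊕ perm v1 v5 v2 v3 v6 v4 ∷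
     ⊕ perm v1 v5 v2 v6 v3 v4 ∷ []) ∷
  (doubleton e16 e35 ,
     ⊕ perm v1 v4 v2 v3 v6 v5 ∷ ⊕ perm v1 v4 v2 v6 v3 v5 ∷ ⊖ perm v1 v4 v3 v5 v6 v2 ∷ ⊖ perm v1 v5 v2 v3 v6 v4 ∷
     ⊖ perm v1 v5 v2 v6 v3 v4 ∷ ⊖ perm v2 v1 v3 v4 v6 v5 ∷ ⊕ perm v2 v4 v3 v1 v6 v5 ∷ []) ∷
  (doubleton e24 e35 ,
     ⊕ perm v1 v2 v3 v5 v6 v4 ∷ ⊕ perm v5 v1 v3 v4 v6 v2 ∷ []) ∷
  (doubleton e24 e36 ,
     ⊕ perm v1 v2 v3 v5 v4 v6 ∷ ⊕ perm v2 v1 v3 v4 v5 v6 ∷ []) ∷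
  (doubleton e25 e34 ,
     ⊖ perm v1 v2 v3 v6 v5 v4 ∷ ⊕ perm v2 v1 v3 v6 v4 v5 ∷ []) ∷
  (doubleton e25 e36 ,
     ⊕ perm v1 v2 v3 v5 v4 v6 ∷ ⊖ perm v2 v1 v3 v4 v5 v6 ∷ []) ∷
  (doubleton e26 e34 ,
     ⊕ perm v1 v2 v3 v6 v5 v4 ∷ ⊕ perm v2 v1 v3 v6 v4 v5 ∷ []) ∷
  (doubleton e26 e35 ,
     ⊖ perm v1 v2 v3 v5 v6 v4 ∷ ⊕ perm v2 v1 v3 v4 v6 v5 ∷ []) ∷
  []

S₅₆ : Subset 6
S₅₆ = doubleton v5 v6

hSupport : List (Fin 9 × Subset 6)
hSupport =
  (e14 , doubleton v1 v2) ∷ (e16 , doubleton v1 v5) ∷ (e16 , doubleton v1 v3) ∷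
  (e25 , doubleton v1 v2) ∷ (e26 , doubleton v2 v4) ∷ (e34 , doubleton v3 v6) ∷ []

H : Fin 9 → Subset 6 → ℤ
H e β = if any (λ entry → (e ==ᶠ proj₁ entry) ∧ does (≡-dec _≟ᵇ_ β (proj₂ entry))) hSupport then 1ℤ else 0ℤ

h : Fin (#E K33) → Map 6 → ℤ
h e = H e ∘ preimage (Vec.lookup S₅₆)

components : Subset 9 → Fin 6 → Fin 6
components = componentLabels endpoints

orbitSumsEven? : ∀ Y e e′ → Dec (∀ β → + 2 ∣ ∑ Y (λ τ → H e (permute τ β) + H e′ (permute τ β)))
orbitSumsEven? Y e e′ = ∀-Subset? λ β → + 2 ∣? ∑ Y (λ τ → H e (permute τ β) + H e′ (permute τ β))

youngSum : Subset 9 → ℤS 6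
youngSum F = ones (youngPerms (components F))

-- c and z with each a_F replaced by its Young-subgroup sum; these are what the checks evaluate.
c ĉ z ẑ : Chain K33
c = tableChain K33 cTable
z = tableChain K33 zTable
ĉ F = select cTable F *ˢ youngSum F
ẑ F = select zTable F *ˢ youngSum F

Labelled : Subset 9 → Set
Labelled F = IsComponentLabelling K33 F (components F)

labelled? : ∀ F → Dec (Labelled F)
labelled? F = isComponentLabelling? K33 F (components F)

c-entries : All (λ entry → ∣ proj₁ entry ∣ ≡ 1 × InℤS (proj₂ entry)) cTable
c-entries = from-yes (All.all? (λ entry → ∣ proj₁ entry ∣ ℕ.≟ 1 ×-dec All.all? (T? ∘ isPerm ∘ proj₂) (proj₂ entry)) cTable)

z-entries : All (λ entry → ∣ proj₁ entry ∣ ≡ 2 × InℤS (proj₂ entry)) zTable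
z-entries = from-yes (All.all? (λ entry → ∣ proj₁ entry ∣ ℕ.≟ 2 ×-dec All.all? (T? ∘ isPerm ∘ proj₂) (proj₂ entry)) zTable)

c-keys-labelled : All (Labelled ∘ proj₁) cTable
c-keys-labelled = from-yes (All.all? (labelled? ∘ proj₁) cTable)

z-keys-labelled : All (Labelled ∘ proj₁) zTable
z-keys-labelled = from-yes (All.all? (labelled? ∘ proj₁) zTable)

pairs-labelled : ∀ e e′ → Labelled (doubleton e e′)
pairs-labelled = from-yes (all? λ e → all? λ e′ → labelled? (doubleton e e′))

pair-orbits-even : ∀ e e′ β →
                   + 2 ∣ ∑ (youngPerms (components (doubleton e e′))) (λ τ → H e (permute τ β) + H e′ (permute τ β))
pair-orbits-even = from-yes (all? λ e → all? λ e′ → orbitSumsEven? (youngPerms (components (doubleton e e′))) e e′)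

ĉ-cycle : ∀ F → T (d K33 ĉ F ==ˢ 0ˢ)
ĉ-cycle = from-yes (∀-Subset? λ F → T? (d K33 ĉ F ==ˢ 0ˢ))

dẑ≡2ĉ : ∀ F → T (d K33 ẑ F ==ˢ ((+ 2) ·ˢ ĉ F))
dẑ≡2ĉ = from-yes (∀-Subset? λ F → T? (d K33 ẑ F ==ˢ ((+ 2) ·ˢ ĉ F)))

open PairingFunctional K33 h

Φĉ-odd : ¬ (+ 2 ∣ Φ ĉ)
Φĉ-odd = from-no (+ 2 ∣? Φ ĉ)

c≋ĉ : ∀ F → c F ≋ ĉ F
c≋ĉ = select-*ˢ-cong cTable {a K33} {youngSum}
        (All.map (λ {entry} → a≋ones-youngPerms K33 (proj₁ entry)) c-keys-labelled)

z≋ẑ : ∀ F → z F ≋ ẑ F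
z≋ẑ = select-*ˢ-cong zTable {a K33} {youngSum}
        (All.map (λ {entry} → a≋ones-youngPerms K33 (proj₁ entry)) z-keys-labelled)

-- The checks run at the literal size 9, since at size #E K33 every step would recompute the edge list
-- of K₃,₃. They are moved to #E K33 along this definitional equality, with the endpoints of subst given
-- explicitly: otherwise the conversion checker unfolds youngPerms and a while comparing the two sizes.
doubleton-at-#E : ∀ (e e′ : Fin 9) → doubleton e e′ ≡ doubleton {#E K33} e e′
doubleton-at-#E e e′ = refl

pairs-even : ∀ {e e′ : Fin (#E K33)} → e ≢ e′ → ∀ y →
             + 2 ∣ linear (λ σ → h e σ + h e′ σ) (y *ˢ a K33 (doubleton e e′))
pairs-even {e} {e′} _ y = subst (+ 2 ∣_)
  (sym (linear-resp-≋ (λ σ → h e σ + h e′ σ) (y *ˢ a K33 (doubleton e e′)) (y *ˢ youngSum (doubleton e e′))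
         (*ˢ-congʳ y {a K33 (doubleton e e′)} {youngSum (doubleton e e′)}
                   (a≋ones-youngPerms K33 (doubleton e e′) labelled))))
  (2∣-linear-*ˢ-ones (Vec.lookup S₅₆) (λ β → H e β + H e′ β) (youngPerms (components (doubleton e e′))) orbits-even y)
  where
  labelled : IsComponentLabelling K33 (doubleton e e′) (components (doubleton e e′))
  labelled = subst (λ D → IsComponentLabelling K33 D (components D)) {doubleton {9} e e′} {doubleton e e′}
                   (doubleton-at-#E e e′) (pairs-labelled e e′)
  orbits-even : ∀ β → + 2 ∣ ∑ (youngPerms (components (doubleton e e′))) (λ τ → H e (permute τ β) + H e′ (permute τ β))
  orbits-even = subst (λ D → ∀ β → + 2 ∣ ∑ (youngPerms (components D)) (λ τ → H e (permute τ β) + H e′ (permute τ β)))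
                      {doubleton {9} e e′} {doubleton e e′} (doubleton-at-#E e e′) (pair-orbits-even e e′)

theorem4p2 : HasOrder2Class K33 1
theorem4p2 = c , (tableChain-isChain K33 1 cTable c-entries , c-cycle) , c-not-boundary , 2c-boundary
  where
  c-cycle : ∀ F → d K33 c F ≋ 0ˢ
  c-cycle F σ = trans (d-cong K33 {c} {ĉ} c≋ĉ F σ) (==ˢ-sound (d K33 ĉ F) 0ˢ (ĉ-cycle F) σ)
  2c-boundary : IsBoundary K33 1 (scaleᶜ K33 (+ 2) c)
  2c-boundary = z , tableChain-isChain K33 2 zTable z-entries , λ F σ →
    trans (d-cong K33 {z} {ẑ} z≋ẑ F σ)
          (trans (==ˢ-sound (d K33 ẑ F) ((+ 2) ·ˢ ĉ F) (dẑ≡2ĉ F) σ) (·ˢ-congʳ (+ 2) {ĉ F} {c F} (λ π → sym (c≋ĉ F π)) σ))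
  c-not-boundary : ¬ IsBoundary K33 1 c
  c-not-boundary (w , w∈C₂ , dw≋c) =
    Φĉ-odd (subst (+ 2 ∣_) (trans (Φ-resp-≋ (d K33 w) c dw≋c) (Φ-resp-≋ c ĉ c≋ĉ)) (Φ∘d-even pairs-even w w∈C₂))
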